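{- Let $p$ be a prime, $n,m\in\mathbb{N}$, $0\le k\le m$ and $0\le j<i\le n$. Then, as ideals of $R_mG_i$, $$\langle P(i,j)\rangle\cap\langle p^k\rangle=\langle p^kP(i,j)\rangle.$$
   Context: $G$ is cyclic of order $p^n$ with generator $\sigma$; $G_i$ is its quotient of order $p^i$ (the image of $\sigma$ is still written $\sigma$). $R_m=\mathbb{Z}/p^m\mathbb{Z}$, $R_mG_i$ the group ring. $P(i,j)=\sum_{k=0}^{p^{i-j}-1}\sigma^{kp^j}$, viewed in $R_mG_i$. $\langle\cdot\rangle$ denotes the ideal generated. -}

module Defs where

open import Data.Nat as ℕ using (ℕ; _≟_; _∸_)
open import Data.Integer as ℤ using (ℤ; +_; 0ℤ; 1ℤ; _-_)
open import Data.Integer.Divisibility as ℤD using ()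
open import Data.List using (List; foldr; map; upTo)
open import Data.Bool using (if_then_else_; _∨_)
open import Data.Product using (∃; _×_)
open import Relation.Nullary.Decidable using (⌊_⌋)

Σℤ : ℕ → (ℕ → ℤ) → ℤ
Σℤ N f = foldr ℤ._+_ 0ℤ (map f (upTo N))

-- Elements of the group ring ℤ G_N (G_N cyclic of order N, generator σ):
-- a function t ↦ coefficient of σ^t; only the values at t < N matter.
GR : Set
GR = ℕ → ℤ

-- Equality in R_m G_N = (ℤ/q) G_N  (q = p^m): coefficientwise congruence mod q
-- on the exponents 0 ≤ t < N.
Eq : (N q : ℕ) → GR → GR → Set
Eq N q a b = ∀ t → t ℕ.< N → (+ q) ℤD.∣ (a t - b t)

-- Product in the group ring of the cyclic group of order N:
-- σ^u σ^v = σ^t  where t ≡ u + v (mod N); for u, v, t < N this means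
-- u + v = t or u + v = t + N.
mul : ℕ → GR → GR → GR
mul N a b t = Σℤ N λ u → Σℤ N λ v →
  if ⌊ u ℕ.+ v ≟ t ⌋ ∨ ⌊ u ℕ.+ v ≟ t ℕ.+ N ⌋ then a u ℤ.* b v else 0ℤ

σ^ : ℕ → GR
σ^ e t = if ⌊ e ≟ t ⌋ then 1ℤ else 0ℤ

const : ℤ → GR
const c t = if ⌊ 0 ≟ t ⌋ then c else 0ℤ

P : (p i j : ℕ) → GR
P p i j t = Σℤ (p ℕ.^ (i ∸ j)) λ k → σ^ (k ℕ.* p ℕ.^ j) t

-- x ∈ ⟨a⟩ in R_m G_N (q = p^m): x is a multiple of a (the ring is commutative)
InIdeal : (N q : ℕ) → GR → GR → Set
InIdeal N q a x = ∃ λ r → Eq N q x (mul N r a)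

-- Write N = p^i, d = p^j, e = p^k. The element e·P(i,j) of R_m G_i has coefficient e
-- at the exponents divisible by d and 0 elsewhere, so the coefficient of σ^t in a
-- multiple of it is e times a sum depending only on t mod d. Hence x lies in its ideal
-- iff x is d-periodic and all its coefficients are divisible by e (a preimage is x/e on
-- the exponents below d). P(i,j) is of this shape with e = 1, and p^k with d = N, where
-- periodicity is vacuous; so both sides of the claimed equality are the set of
-- d-periodic x with coefficients divisible by p^k.

module Submission where

open import Defs
open import Data.Nat using (ℕ; _≤_; _<_; _^_)
open import Data.Nat.Primality using (Prime)
open import Data.Integer using (+_)
open import Data.Product using (_×_)
open import Function.Bundles using (_⇔_)

open import Data.Bool using (true; false; if_then_else_; _∨_)
open import Data.Bool.Properties using (∨-zeroʳ)
open import Data.Integer as ℤ using (ℤ; 0ℤ; _-_)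
import Data.Integer.Properties as ℤₚ
open import Data.Integer.Divisibility.Signed as ℤ∣ using () renaming (_∣_ to _∣ℤ_)
open import Data.Integer.Tactic.RingSolver using (solve-∀)
open import Data.List using (foldr)
open import Data.List.Properties using (map-applyUpTo)
open import Data.Nat.Base using (zero; suc; _+_; _*_; _∸_; NonZero; >-nonZero⁻¹; z<s; s<s)
open import Data.Nat.DivMod
  using (_%_; _/_; m≡m%n+[m/n]*n; [m+kn]%n≡m%n; m%n%n≡m%n; m%n<n; m%n≤m; m<n⇒m%n≡m)
open import Data.Nat.Divisibility
  using (_∣_; divides; _∣?_; _∣0; 1∣_; ∣-refl; ∣⇒≤; n∣m*n; ∣m∣n⇒∣m+n; ∣m+n∣m⇒∣n)
open import Data.Nat.Primality using (prime⇒nonZero)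
open import Data.Nat.Properties
  using (_≟_; _≤?_; _<?_; +-assoc; +-identityʳ; +-cancelˡ-≡; m≤n+m; m∸n≤m; m+[n∸m]≡n;
         ≤-trans; <⇒≤; <⇒≱; ≰⇒>; <-≤-trans; ≤-<-trans; +-monoˡ-<; +-cancelˡ-<; suc-injective;
         *-cancelʳ-<; *-cancelʳ-≡;
         m^n≢0; ^-distribˡ-+-*; m∸n+n≡m)
open import Data.Product using (_,_; proj₁; proj₂)
open import Data.Sum using (_⊎_; inj₁; inj₂)
open import Function using (_∘_; id)
open import Function.Bundles using (mk⇔; Equivalence)
open import Relation.Binary.PropositionalEquality
open import Relation.Nullary using (¬_; yes; no; contradiction)
open import Relation.Nullary.Decidable using (Dec; ⌊_⌋; isYes≗does; dec-true; dec-false)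

open Equivalence using (to; from)
open ≡-Reasoning

⌊⌋-true : ∀ {a} {A : Set a} (a? : Dec A) → A → ⌊ a? ⌋ ≡ true
⌊⌋-true a? a = trans (isYes≗does a?) (dec-true a? a)

⌊⌋-false : ∀ {a} {A : Set a} (a? : Dec A) → ¬ A → ⌊ a? ⌋ ≡ false
⌊⌋-false a? ¬a = trans (isYes≗does a?) (dec-false a? ¬a)

Σℤ-suc : ∀ n (f : ℕ → ℤ) → Σℤ (suc n) f ≡ f 0 ℤ.+ Σℤ n (f ∘ suc)
Σℤ-suc n f = cong (λ xs → f 0 ℤ.+ foldr ℤ._+_ 0ℤ xs)
  (trans (map-applyUpTo suc f n) (sym (map-applyUpTo id (f ∘ suc) n)))

Σℤ-cong : ∀ n {f g : ℕ → ℤ} → (∀ u → u < n → f u ≡ g u) → Σℤ n f ≡ Σℤ n g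
Σℤ-cong zero    f≗g = refl
Σℤ-cong (suc n) {f} {g} f≗g = begin
  Σℤ (suc n) f           ≡⟨ Σℤ-suc n f ⟩
  f 0 ℤ.+ Σℤ n (f ∘ suc) ≡⟨ cong₂ ℤ._+_ (f≗g 0 z<s)
                                        (Σℤ-cong n (λ u u<n → f≗g (suc u) (s<s u<n))) ⟩
  g 0 ℤ.+ Σℤ n (g ∘ suc) ≡⟨ Σℤ-suc n g ⟨
  Σℤ (suc n) g           ∎

Σℤ-zero : ∀ n {f : ℕ → ℤ} → (∀ u → u < n → f u ≡ 0ℤ) → Σℤ n f ≡ 0ℤ
Σℤ-zero zero    f≗0 = refl
Σℤ-zero (suc n) {f} f≗0 = begin
  Σℤ (suc n) f           ≡⟨ Σℤ-suc n f ⟩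
  f 0 ℤ.+ Σℤ n (f ∘ suc) ≡⟨ cong₂ ℤ._+_ (f≗0 0 z<s)
                                        (Σℤ-zero n (λ u u<n → f≗0 (suc u) (s<s u<n))) ⟩
  0ℤ                     ∎

Σℤ-delta : ∀ n {f : ℕ → ℤ} {w} → w < n → (∀ u → u < n → u ≢ w → f u ≡ 0ℤ) → Σℤ n f ≡ f w
Σℤ-delta (suc n) {f} {zero} _ off = begin
  Σℤ (suc n) f           ≡⟨ Σℤ-suc n f ⟩
  f 0 ℤ.+ Σℤ n (f ∘ suc) ≡⟨ cong (λ s → f 0 ℤ.+ s)
                                   (Σℤ-zero n (λ u u<n → off (suc u) (s<s u<n) λ ())) ⟩
  f 0 ℤ.+ 0ℤ             ≡⟨ ℤₚ.+-identityʳ (f 0) ⟩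
  f 0                    ∎
Σℤ-delta (suc n) {f} {suc w} (s<s w<n) off = begin
  Σℤ (suc n) f           ≡⟨ Σℤ-suc n f ⟩
  f 0 ℤ.+ Σℤ n (f ∘ suc) ≡⟨ cong₂ ℤ._+_ (off 0 z<s λ ()) (Σℤ-delta n w<n off′) ⟩
  0ℤ ℤ.+ f (suc w)       ≡⟨ ℤₚ.+-identityˡ (f (suc w)) ⟩
  f (suc w)              ∎
  where
  off′ : ∀ u → u < n → u ≢ w → f (suc u) ≡ 0ℤ
  off′ u u<n u≢w = off (suc u) (s<s u<n) (u≢w ∘ suc-injective)

∣-Σℤ : ∀ n {k} {f : ℕ → ℤ} → (∀ u → u < n → k ∣ℤ f u) → k ∣ℤ Σℤ n f
∣-Σℤ zero    {k} k∣f = ℤ∣.divides 0ℤ (sym (ℤₚ.*-zeroˡ k))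
∣-Σℤ (suc n) {k} {f} k∣f = subst (k ∣ℤ_) (sym (Σℤ-suc n f))
  (ℤ∣.∣m∣n⇒∣m+n (k∣f 0 z<s) (∣-Σℤ n (λ u u<n → k∣f (suc u) (s<s u<n))))

[m+n]%d≡m%d : ∀ m {n d} .{{_ : NonZero d}} → d ∣ n → (m + n) % d ≡ m % d
[m+n]%d≡m%d m {d = d} (divides k refl) = [m+kn]%n≡m%n m k d

+≡+⇒[∣⇔%≡] : ∀ {u w t c d} .{{_ : NonZero d}} → u + w ≡ t + c → d ∣ c →
             (d ∣ w ⇔ u % d ≡ t % d)
+≡+⇒[∣⇔%≡] {u} {w} {t} {c} {d} u+w≡t+c d∣c = mk⇔ residues-agree divides-w
  where
  residues-agree : d ∣ w → u % d ≡ t % d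
  residues-agree d∣w = begin
    u % d       ≡⟨ [m+n]%d≡m%d u d∣w ⟨
    (u + w) % d ≡⟨ cong (_% d) u+w≡t+c ⟩
    (t + c) % d ≡⟨ [m+n]%d≡m%d t d∣c ⟩
    t % d       ∎

  divides-w : u % d ≡ t % d → d ∣ w
  divides-w u≡t =
    ∣m+n∣m⇒∣n (subst (d ∣_) (sym quotients) (∣m∣n⇒∣m+n (n∣m*n (t / d)) d∣c)) (n∣m*n (u / d))
    where
    quotients : (u / d) * d + w ≡ (t / d) * d + c
    quotients = +-cancelˡ-≡ (u % d) _ _ (begin
      u % d + ((u / d) * d + w) ≡⟨ +-assoc (u % d) _ w ⟨
      (u % d + (u / d) * d) + w ≡⟨ cong (_+ w) (m≡m%n+[m/n]*n u d) ⟨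
      u + w                     ≡⟨ u+w≡t+c ⟩
      t + c                     ≡⟨ cong (_+ c) (m≡m%n+[m/n]*n t d) ⟩
      (t % d + (t / d) * d) + c ≡⟨ cong (λ r → (r + (t / d) * d) + c) u≡t ⟨
      (u % d + (t / d) * d) + c ≡⟨ +-assoc (u % d) _ c ⟩
      u % d + ((t / d) * d + c) ∎)

-- b = e · Σ_{k < N/d} σ^(k d), e times the norm element of the subgroup generated by σ^d.
IsScaledNorm : (N d e : ℕ) → GR → Set
IsScaledNorm N d e b = ∀ v → v < N → (d ∣ v → b v ≡ + e) × (¬ d ∣ v → b v ≡ 0ℤ)

Periodic : (N q d : ℕ) .{{_ : NonZero d}} → GR → Set
Periodic N q d x = ∀ t → t < N → + q ∣ℤ x t - x (t % d)

Divisible : (N e : ℕ) → GR → Set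
Divisible N e x = ∀ t → t < N → + e ∣ℤ x t

scaledNorm-divisible : ∀ {N d e b} → IsScaledNorm N d e b → Divisible N e b
scaledNorm-divisible {d = d} {e} b-norm v v<N with d ∣? v
... | yes d∣v = subst (+ e ∣ℤ_) (sym (proj₁ (b-norm v v<N) d∣v)) ℤ∣.∣-refl
... | no  d∤v = subst (+ e ∣ℤ_) (sym (proj₂ (b-norm v v<N) d∤v))
                      (ℤ∣.divides 0ℤ (sym (ℤₚ.*-zeroˡ (+ e))))

norm-isScaledNorm : ∀ {M d N} .{{_ : NonZero d}} → M * d ≡ N →
  IsScaledNorm N d 1 (λ v → Σℤ M (λ k → σ^ (k * d) v))
norm-isScaledNorm {M} {d} refl v v<Md = on-multiples , off-multiples
  where
  σ^-diag : ∀ {a b} → a ≡ b → σ^ a b ≡ + 1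
  σ^-diag {a} {b} a≡b = cong (if_then + 1 else 0ℤ) (⌊⌋-true (a ≟ b) a≡b)

  σ^-off : ∀ {a b} → a ≢ b → σ^ a b ≡ 0ℤ
  σ^-off {a} {b} a≢b = cong (if_then + 1 else 0ℤ) (⌊⌋-false (a ≟ b) a≢b)

  on-multiples : d ∣ v → Σℤ M (λ k → σ^ (k * d) v) ≡ + 1
  on-multiples (divides c v≡cd) = trans (Σℤ-delta M c<M off) (σ^-diag (sym v≡cd))
    where
    c<M : c < M
    c<M = *-cancelʳ-< d c M (subst (_< M * d) v≡cd v<Md)
    off : ∀ k → k < M → k ≢ c → σ^ (k * d) v ≡ 0ℤ
    off k _ k≢c = σ^-off (λ kd≡v → k≢c (*-cancelʳ-≡ k c d (trans kd≡v v≡cd)))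

  off-multiples : ¬ d ∣ v → Σℤ M (λ k → σ^ (k * d) v) ≡ 0ℤ
  off-multiples d∤v = Σℤ-zero M (λ k _ → σ^-off (λ kd≡v → d∤v (divides k (sym kd≡v))))

i-k≡[i-j]-[k-j] : ∀ i j k → i - k ≡ (i - j) - (k - j)
i-k≡[i-j]-[k-j] = solve-∀

Eq⇒periodic : ∀ {N q d x y} .{{_ : NonZero d}} →
              Eq N q x y → (∀ t → t < N → y t ≡ y (t % d)) → Periodic N q d x
Eq⇒periodic {q = q} {d} {x} {y} x≈y y-periodic t t<N =
  subst (+ q ∣ℤ_) (sym (i-k≡[i-j]-[k-j] (x t) (y (t % d)) (x (t % d))))
    (ℤ∣.∣m∣n⇒∣m-n (subst (λ z → + q ∣ℤ x t - z) (y-periodic t t<N) (ℤ∣.∣ᵤ⇒∣ (x≈y t t<N)))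
                  (ℤ∣.∣ᵤ⇒∣ (x≈y (t % d) (≤-<-trans (m%n≤m t d) t<N))))

Eq⇒divisible : ∀ {N q e x y} → e ∣ q → Eq N q x y → Divisible N e y → Divisible N e x
Eq⇒divisible {q = q} {e} {x} {y} e∣q x≈y e∣y t t<N =
  ℤ∣.∣m+n∣n⇒∣m (ℤ∣.∣-trans (ℤ∣.∣ᵤ⇒∣ {+ e} {+ q} e∣q) (ℤ∣.∣ᵤ⇒∣ (x≈y t t<N)))
               (ℤ∣.∣m⇒∣-m (e∣y t t<N))

module _ (N : ℕ) .{{_ : NonZero N}} where

  AddsTo : ℕ → ℕ → ℕ → Set
  AddsTo u w t = u + w ≡ t ⊎ u + w ≡ t + N

  _⊝_ : ℕ → ℕ → ℕ
  t ⊝ u with u ≤? t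
  ... | yes _ = t ∸ u
  ... | no  _ = t + N ∸ u

  ⊝-spec : ∀ {t u} → t < N → u < N → t ⊝ u < N × AddsTo u (t ⊝ u) t
  ⊝-spec {t} {u} t<N u<N with u ≤? t
  ... | yes u≤t = ≤-<-trans (m∸n≤m t u) t<N , inj₁ (m+[n∸m]≡n u≤t)
  ... | no  u≰t =
    +-cancelˡ-< u _ N (subst (_< u + N) (sym wraps) (+-monoˡ-< N (≰⇒> u≰t))) , inj₂ wraps
    where
    wraps : u + (t + N ∸ u) ≡ t + N
    wraps = m+[n∸m]≡n (≤-trans (<⇒≤ u<N) (m≤n+m N t))

  private
    no-wrap : ∀ {u v w t} → u + v ≡ t → u + w ≡ t + N → ¬ w < N
    no-wrap {u} {v} {w} refl u+w≡u+v+N w<N = <⇒≱ w<N (subst (N ≤_) (sym w≡v+N) (m≤n+m N v))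
      where
      w≡v+N : w ≡ v + N
      w≡v+N = +-cancelˡ-≡ u w (v + N) (trans u+w≡u+v+N (+-assoc u v N))

  adds-unique : ∀ {u v w t} → v < N → w < N → AddsTo u v t → AddsTo u w t → v ≡ w
  adds-unique {u} {v} {w} _   _   (inj₁ eq) (inj₁ eq′) = +-cancelˡ-≡ u v w (trans eq (sym eq′))
  adds-unique {u} {v} {w} _   _   (inj₂ eq) (inj₂ eq′) = +-cancelˡ-≡ u v w (trans eq (sym eq′))
  adds-unique             _   w<N (inj₁ eq) (inj₂ eq′) = contradiction w<N (no-wrap eq eq′)
  adds-unique             v<N _   (inj₂ eq) (inj₁ eq′) = contradiction v<N (no-wrap eq′ eq)

  private
    adds-cond : ∀ {u v t} → AddsTo u v t → (⌊ u + v ≟ t ⌋ ∨ ⌊ u + v ≟ t + N ⌋) ≡ true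
    adds-cond {u} {v} {t} (inj₁ eq) = cong (_∨ ⌊ u + v ≟ t + N ⌋) (⌊⌋-true (u + v ≟ t) eq)
    adds-cond {u} {v} {t} (inj₂ eq) =
      trans (cong (⌊ u + v ≟ t ⌋ ∨_) (⌊⌋-true (u + v ≟ t + N) eq)) (∨-zeroʳ ⌊ u + v ≟ t ⌋)

    ¬adds-cond : ∀ {u v t} → ¬ AddsTo u v t → (⌊ u + v ≟ t ⌋ ∨ ⌊ u + v ≟ t + N ⌋) ≡ false
    ¬adds-cond {u} {v} {t} ¬adds =
      cong₂ _∨_ (⌊⌋-false (u + v ≟ t) (¬adds ∘ inj₁)) (⌊⌋-false (u + v ≟ t + N) (¬adds ∘ inj₂))

  mul-conv : ∀ (a b : GR) {t} → t < N → mul N a b t ≡ Σℤ N (λ u → a u ℤ.* b (t ⊝ u))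
  mul-conv a b {t} t<N = Σℤ-cong N inner
    where
    term : ℕ → ℕ → ℤ
    term u v = if ⌊ u + v ≟ t ⌋ ∨ ⌊ u + v ≟ t + N ⌋ then a u ℤ.* b v else 0ℤ

    inner : ∀ u → u < N → Σℤ N (term u) ≡ a u ℤ.* b (t ⊝ u)
    inner u u<N =
      trans (Σℤ-delta N w<N off) (cong (if_then a u ℤ.* b w else 0ℤ) (adds-cond {u} {w} {t} adds))
      where
      w : ℕ
      w = t ⊝ u
      w<N : w < N
      w<N = proj₁ (⊝-spec t<N u<N)
      adds : AddsTo u w t
      adds = proj₂ (⊝-spec t<N u<N)
      off : ∀ v → v < N → v ≢ w → term u v ≡ 0ℤ
      off v v<N v≢w = cong (if_then a u ℤ.* b v else 0ℤ)
        (¬adds-cond {u} {v} {t} (λ adds′ → v≢w (adds-unique v<N w<N adds′ adds)))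

  mul-divisible : ∀ {k b} → Divisible N k b → ∀ a → Divisible N k (mul N a b)
  mul-divisible {k} {b} k∣b a t t<N = subst (+ k ∣ℤ_) (sym (mul-conv a b t<N))
    (∣-Σℤ N (λ u u<N → ℤ∣.∣n⇒∣m*n (a u) (k∣b (t ⊝ u) (proj₁ (⊝-spec t<N u<N)))))

  mul-const : ∀ c (b : GR) {v} → v < N → mul N (const c) b v ≡ c ℤ.* b v
  mul-const c b {v} v<N = trans (mul-conv (const c) b v<N) (Σℤ-delta N (>-nonZero⁻¹ N) off)
    where
    off : ∀ u → u < N → u ≢ 0 → const c u ℤ.* b (v ⊝ u) ≡ 0ℤ
    off zero    _ 0≢0 = contradiction refl 0≢0
    off (suc u) _ _   = ℤₚ.*-zeroˡ (b (v ⊝ suc u))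

  const-isScaledNorm : ∀ e → IsScaledNorm N N e (const (+ e))
  const-isScaledNorm e zero    _   = (λ _ → refl) , (λ N∤0 → contradiction (N ∣0) N∤0)
  const-isScaledNorm e (suc v) v<N = (λ N∣v → contradiction (∣⇒≤ N∣v) (<⇒≱ v<N)) , (λ _ → refl)

  mul-const-isScaledNorm : ∀ {d b} e → IsScaledNorm N d 1 b →
                           IsScaledNorm N d e (mul N (const (+ e)) b)
  mul-const-isScaledNorm {b = b} e b-norm v v<N =
      (λ d∣v → trans (scaled (proj₁ (b-norm v v<N) d∣v)) (ℤₚ.*-identityʳ (+ e)))
    , (λ d∤v → trans (scaled (proj₂ (b-norm v v<N) d∤v)) (ℤₚ.*-zeroʳ (+ e)))
    where
    scaled : ∀ {c} → b v ≡ c → mul N (const (+ e)) b v ≡ + e ℤ.* c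
    scaled bv≡c = trans (mul-const (+ e) b v<N) (cong (+ e ℤ.*_) bv≡c)

  periodic-whole : ∀ q x → Periodic N q N x
  periodic-whole q x t t<N = subst (λ s → + q ∣ℤ x t - x s) (sym (m<n⇒m%n≡m t<N))
    (subst (+ q ∣ℤ_) (sym (ℤₚ.+-inverseʳ (x t))) (ℤ∣.divides 0ℤ (sym (ℤₚ.*-zeroˡ (+ q)))))

  module _ {d} .{{_ : NonZero d}} (d∣N : d ∣ N) where

    ∣⊝⇔%≡ : ∀ {t u} → t < N → u < N → (d ∣ t ⊝ u ⇔ u % d ≡ t % d)
    ∣⊝⇔%≡ {t} t<N u<N with proj₂ (⊝-spec t<N u<N)
    ... | inj₁ eq = +≡+⇒[∣⇔%≡] (trans eq (sym (+-identityʳ t))) (d ∣0)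
    ... | inj₂ eq = +≡+⇒[∣⇔%≡] eq d∣N

    module _ {e b} (b-norm : IsScaledNorm N d e b) where

      norm-⊝ : ∀ {t u} → t < N → u < N →
               (u % d ≡ t % d → b (t ⊝ u) ≡ + e) × (u % d ≢ t % d → b (t ⊝ u) ≡ 0ℤ)
      norm-⊝ {t} {u} t<N u<N =
        proj₁ values ∘ from (∣⊝⇔%≡ t<N u<N) , proj₂ values ∘ (_∘ to (∣⊝⇔%≡ t<N u<N))
        where
        values : (d ∣ t ⊝ u → b (t ⊝ u) ≡ + e) × (¬ d ∣ t ⊝ u → b (t ⊝ u) ≡ 0ℤ)
        values = b-norm (t ⊝ u) (proj₁ (⊝-spec t<N u<N))

      norm-⊝-cong : ∀ {t t′ u} → t < N → t′ < N → u < N → t % d ≡ t′ % d → b (t ⊝ u) ≡ b (t′ ⊝ u)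
      norm-⊝-cong {t} {t′} {u} t<N t′<N u<N t≡t′ with u % d ≟ t % d
      ... | yes u≡t = trans (proj₁ (norm-⊝ t<N u<N) u≡t)
                            (sym (proj₁ (norm-⊝ t′<N u<N) (trans u≡t t≡t′)))
      ... | no  u≢t = trans (proj₂ (norm-⊝ t<N u<N) u≢t)
                            (sym (proj₂ (norm-⊝ t′<N u<N) (λ u≡t′ → u≢t (trans u≡t′ (sym t≡t′)))))

      mul-periodic : ∀ a {t} → t < N → mul N a b t ≡ mul N a b (t % d)
      mul-periodic a {t} t<N = begin
        mul N a b t                           ≡⟨ mul-conv a b t<N ⟩
        Σℤ N (λ u → a u ℤ.* b (t ⊝ u))       ≡⟨ Σℤ-cong N (λ u → cong (a u ℤ.*_) ∘ same-residue) ⟩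
        Σℤ N (λ u → a u ℤ.* b ((t % d) ⊝ u)) ≡⟨ mul-conv a b t%d<N ⟨
        mul N a b (t % d)                     ∎
        where
        t%d<N : t % d < N
        t%d<N = ≤-<-trans (m%n≤m t d) t<N
        same-residue : ∀ {u} → u < N → b (t ⊝ u) ≡ b ((t % d) ⊝ u)
        same-residue u<N = norm-⊝-cong t<N t%d<N u<N (sym (m%n%n≡m%n t d))

      module _ {x} (e∣x : Divisible N e x) where

        private
          d≤N : d ≤ N
          d≤N = ∣⇒≤ d∣N

        quot-below : GR
        quot-below u with u <? d
        ... | yes u<d = ℤ∣.quotient (e∣x u (<-≤-trans u<d d≤N))
        ... | no  _   = 0ℤ

        quot-below-< : ∀ {u} → u < d → quot-below u ℤ.* + e ≡ x u
        quot-below-< {u} u<d with u <? d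
        ... | yes u<d′ = sym (ℤ∣._∣_.equality (e∣x u (<-≤-trans u<d′ d≤N)))
        ... | no  u≮d  = contradiction u<d u≮d

        quot-below-≮ : ∀ {u} → ¬ u < d → quot-below u ≡ 0ℤ
        quot-below-≮ {u} u≮d with u <? d
        ... | yes u<d = contradiction u<d u≮d
        ... | no  _   = refl

        mul-quot-below : ∀ {t} → t < N → mul N quot-below b t ≡ x (t % d)
        mul-quot-below {t} t<N = begin
          mul N quot-below b t                    ≡⟨ mul-conv quot-below b t<N ⟩
          Σℤ N (λ u → quot-below u ℤ.* b (t ⊝ u)) ≡⟨ Σℤ-delta N t%d<N off ⟩
          quot-below (t % d) ℤ.* b (t ⊝ (t % d))  ≡⟨ cong (quot-below (t % d) ℤ.*_) on-residue ⟩
          quot-below (t % d) ℤ.* + e              ≡⟨ quot-below-< (m%n<n t d) ⟩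
          x (t % d)                               ∎
          where
          t%d<N : t % d < N
          t%d<N = ≤-<-trans (m%n≤m t d) t<N
          on-residue : b (t ⊝ (t % d)) ≡ + e
          on-residue = proj₁ (norm-⊝ t<N t%d<N) (m%n%n≡m%n t d)
          off : ∀ u → u < N → u ≢ t % d → quot-below u ℤ.* b (t ⊝ u) ≡ 0ℤ
          off u u<N u≢t = below-or-above (u <? d)
            where
            below-or-above : Dec (u < d) → quot-below u ℤ.* b (t ⊝ u) ≡ 0ℤ
            below-or-above (yes u<d) = trans
              (cong (quot-below u ℤ.*_) (proj₂ (norm-⊝ t<N u<N) (u≢t ∘ trans (sym (m<n⇒m%n≡m u<d)))))
              (ℤₚ.*-zeroʳ (quot-below u))
            below-or-above (no u≮d) =
              trans (cong (ℤ._* b (t ⊝ u)) (quot-below-≮ u≮d)) (ℤₚ.*-zeroˡ (b (t ⊝ u)))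

      inIdeal-scaledNorm⇔ : ∀ {q} → e ∣ q → ∀ x →
                            InIdeal N q b x ⇔ (Periodic N q d x × Divisible N e x)
      inIdeal-scaledNorm⇔ {q} e∣q x = mk⇔ characterise generate
        where
        characterise : InIdeal N q b x → Periodic N q d x × Divisible N e x
        characterise (r , x≈rb) =
            Eq⇒periodic {x = x} {mul N r b} x≈rb (λ t t<N → mul-periodic r t<N)
          , Eq⇒divisible {x = x} {mul N r b} e∣q x≈rb (mul-divisible (scaledNorm-divisible b-norm) r)

        generate : Periodic N q d x × Divisible N e x → InIdeal N q b x
        generate (x-periodic , e∣x) = quot-below e∣x , λ t t<N →
          ℤ∣.∣⇒∣ᵤ (subst (λ s → + q ∣ℤ x t - s) (sym (mul-quot-below e∣x t<N)) (x-periodic t t<N))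

^-split : ∀ p {a b} → b ≤ a → p ^ (a ∸ b) * p ^ b ≡ p ^ a
^-split p {a} {b} b≤a = trans (sym (^-distribˡ-+-* p (a ∸ b) b)) (cong (p ^_) (m∸n+n≡m b≤a))

pᵇ∣pᵃ : ∀ p {a b} → b ≤ a → p ^ b ∣ p ^ a
pᵇ∣pᵃ p {a} {b} b≤a = divides (p ^ (a ∸ b)) (sym (^-split p b≤a))

-- The hypothesis i ≤ n only makes G_i a quotient of G; the argument lives entirely in R_m G_i.
lemma2p4 : (p n m k i j : ℕ) → Prime p → k ≤ m → j < i → i ≤ n →
    (x : GR) →
      (InIdeal (p ^ i) (p ^ m) (P p i j) x × InIdeal (p ^ i) (p ^ m) (const (+ (p ^ k))) x)
        ⇔ InIdeal (p ^ i) (p ^ m) (mul (p ^ i) (const (+ (p ^ k))) (P p i j)) x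
lemma2p4 p n m k i j p-prime k≤m j<i _ x = mk⇔
  (λ (x∈⟨P⟩ , x∈⟨pᵏ⟩) → from ⟨pᵏP⟩ (proj₁ (to ⟨P⟩ x∈⟨P⟩) , proj₂ (to ⟨pᵏ⟩ x∈⟨pᵏ⟩)))
  (λ x∈⟨pᵏP⟩ → let x-periodic , pᵏ∣x = to ⟨pᵏP⟩ x∈⟨pᵏP⟩ in
    from ⟨P⟩ (x-periodic , λ t _ → ℤ∣.∣ᵤ⇒∣ (1∣ _)) , from ⟨pᵏ⟩ (periodic-whole N q x , pᵏ∣x))
  where
  instance
    p≢0 : NonZero p
    p≢0 = prime⇒nonZero p-prime
    pⁱ≢0 : NonZero (p ^ i)
    pⁱ≢0 = m^n≢0 p i
    pʲ≢0 : NonZero (p ^ j)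
    pʲ≢0 = m^n≢0 p j

  N q d e : ℕ
  N = p ^ i
  q = p ^ m
  d = p ^ j
  e = p ^ k

  P-norm : IsScaledNorm N d 1 (P p i j)
  P-norm = norm-isScaledNorm {M = p ^ (i ∸ j)} (^-split p (<⇒≤ j<i))

  ⟨P⟩ : InIdeal N q (P p i j) x ⇔ (Periodic N q d x × Divisible N 1 x)
  ⟨P⟩ = inIdeal-scaledNorm⇔ N (pᵇ∣pᵃ p (<⇒≤ j<i)) P-norm (1∣ q) x

  ⟨pᵏ⟩ : InIdeal N q (const (+ e)) x ⇔ (Periodic N q N x × Divisible N e x)
  ⟨pᵏ⟩ = inIdeal-scaledNorm⇔ N ∣-refl (const-isScaledNorm N e) (pᵇ∣pᵃ p k≤m) x

  ⟨pᵏP⟩ : InIdeal N q (mul N (const (+ e)) (P p i j)) x ⇔ (Periodic N q d x × Divisible N e x)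
  ⟨pᵏP⟩ = inIdeal-scaledNorm⇔ N (pᵇ∣pᵃ p (<⇒≤ j<i)) (mul-const-isScaledNorm N e P-norm) (pᵇ∣pᵃ p k≤m) x
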